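{- Let $\delta\ge 6$, $\mathbf{y}=(1\,2\cdots\delta)^\omega$, $\mathbf{y}'=(1'\,2'\cdots\delta')^\omega$, let $\mathbf{u}$ be a standard sequence whose slope has continued fraction expansion of the form $[0,1,\lfloor\delta/2\rfloor,a_3,\ldots]$, and let $\mathbf{x}_{2\delta}=\mathrm{colour}(\mathbf{u},\mathbf{y},\mathbf{y}')$. Let $w$ be a nonempty factor of $\mathbf{x}_{2\delta}$ such that $\pi(w)$ contains both $\mathtt a$ and $\mathtt b$, and let $v$ be a return word to $w$ in $\mathbf{x}_{2\delta}$. Then: 1. both $|\pi(v)|_{\mathtt a}$ and $|\pi(v)|_{\mathtt b}$ are divisible by $\delta$; 2. if $w$ is a bispecial factor of $\mathbf{x}_{2\delta}$, then $\pi(w)$ is a bispecial factor of $\mathbf{u}$.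
   Context: A Sturmian sequence is an aperiodic binary sequence with exactly $n+1$ factors of each length $n$; a standard sequence is a Sturmian $\mathbf{u}$ such that $\mathtt a\mathbf{u}$ and $\mathtt b\mathbf{u}$ are both Sturmian. Convention: $\rho_{\mathtt b}(\mathbf{u})>\rho_{\mathtt a}(\mathbf{u})$ and the slope is $\rho_{\mathtt a}(\mathbf{u})/\rho_{\mathtt b}(\mathbf{u})$. $\mathrm{colour}(\mathbf{u},\mathbf{y},\mathbf{y}')$ replaces the subsequence of all $\mathtt a$'s in $\mathbf{u}$ by $\mathbf{y}$ and the subsequence of all $\mathtt b$'s by $\mathbf{y}'$. The map $\pi$ sends each letter of $\{1,\ldots,\delta\}$ to $\mathtt a$ and each letter of $\{1',\ldots,\delta'\}$ to $\mathtt b$, extended letterwise to words. If $i<j$ are two consecutive occurrences of a factor $w$ in a sequence $x_0x_1\cdots$, the word $x_i\cdots x_{j-1}$ is a return word to $w$. A factor $w$ is right (left) special if $wa,wb$ (resp. $aw,bw$) are factors for two distinct letters $a,b$; bispecial means both left and right special. -}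

module Defs where

open import Data.Nat using (ℕ; zero; suc; _+_; _*_; _∸_; _≤_; _<_; NonZero)
open import Data.Nat.DivMod using (_mod_)
open import Data.Nat.Divisibility using (_∣_)
open import Data.Fin using (Fin)
open import Data.List using (List; []; _∷_; length; map; _∷ʳ_)
open import Data.List.Membership.Propositional using (_∈_)
open import Data.List.Relation.Unary.Unique.Propositional using (Unique)
open import Data.Sum using (_⊎_; inj₁; inj₂)
open import Data.Product using (Σ; ∃; _×_; _,_; proj₁; proj₂)
open import Relation.Nullary using (¬_)
open import Relation.Binary.PropositionalEquality using (_≡_; _≢_)
open import Function.Bundles using (_⇔_)

data AB : Set where
  a b : AB

Seq : Set → Set
Seq A = ℕ → A

_◂_ : {A : Set} → A → Seq A → Seq A
(c ◂ x) zero = c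
(c ◂ x) (suc n) = x n

slice : {A : Set} → Seq A → ℕ → ℕ → List A
slice x i zero = []
slice x i (suc n) = x i ∷ slice x (suc i) n

OccursAt : {A : Set} → List A → Seq A → ℕ → Set
OccursAt w x i = slice x i (length w) ≡ w

Factor : {A : Set} → List A → Seq A → Set
Factor w x = ∃ λ i → OccursAt w x i

EventuallyPeriodic : {A : Set} → Seq A → Set
EventuallyPeriodic x = Σ ℕ λ p → (0 < p) × Σ ℕ λ N → ∀ n → N ≤ n → x (n + p) ≡ x n

HasComplexity : {A : Set} → Seq A → ℕ → Set
HasComplexity {A} x n =
  Σ (List (List A)) λ L → (length L ≡ suc n) × Unique L ×
    (∀ w → (w ∈ L) ⇔ (Factor w x × length w ≡ n))

Sturmian : Seq AB → Set
Sturmian u = ¬ EventuallyPeriodic u × (∀ n → HasComplexity u n)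

Standard : Seq AB → Set
Standard u = Sturmian u × Sturmian (a ◂ u) × Sturmian (b ◂ u)

-- number of a's / b's among u_0 ... u_{N-1}
countA countB : Seq AB → ℕ → ℕ
countA u zero = zero
countA u (suc N) with u N
... | a = suc (countA u N)
... | b = countA u N
countB u zero = zero
countB u (suc N) with u N
... | a = countB u N
... | b = suc (countB u N)

∣_∣ₐ ∣_∣ᵦ : List AB → ℕ
∣ [] ∣ₐ = 0
∣ a ∷ w ∣ₐ = suc ∣ w ∣ₐ
∣ b ∷ w ∣ₐ = ∣ w ∣ₐ
∣ [] ∣ᵦ = 0
∣ a ∷ w ∣ᵦ = ∣ w ∣ᵦ
∣ b ∷ w ∣ᵦ = suc ∣ w ∣ᵦ

-- Continued fractions [c0; c1, c2, ...].  convPair c n = ((p_{n-1}, q_{n-1}), (p_n, q_n))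
-- with p_{-1} = 1, q_{-1} = 0, p_0 = c0, q_0 = 1, p_n = c_n p_{n-1} + p_{n-2}, etc.
convPair : (ℕ → ℕ) → ℕ → (ℕ × ℕ) × (ℕ × ℕ)
convPair c zero = ((1 , 0) , (c 0 , 1))
convPair c (suc n) with convPair c n
... | ((p' , q') , (p , q)) = ((p , q) , (c (suc n) * p + p' , c (suc n) * q + q'))

-- A/B lies in the closed interval with endpoints p/q and p'/q' (cross-multiplied)
Between : ℕ → ℕ → (ℕ × ℕ) × (ℕ × ℕ) → Set
Between A B ((p , q) , (p' , q')) =
  (p * B ≤ A * q × A * q' ≤ p' * B) ⊎ (p' * B ≤ A * q' × A * q ≤ p * B)

-- The rational sequence A_N / B_N converges to the irrational number [c0; c1, c2, ...]
-- (c n ≥ 1 for n ≥ 1): i.e. for every n it eventually lies between the n-th and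
-- (n+1)-th convergents (these nested intervals shrink to the limit).
ConvergesToCF : (ℕ → ℕ) → (ℕ → ℕ) → (ℕ → ℕ) → Set
ConvergesToCF A B c = ∀ n → Σ ℕ λ N₀ → ∀ N → N₀ ≤ N → Between (A N) (B N) (convPair c (suc n))

-- slope ρ_a(u)/ρ_b(u) of u has continued fraction expansion c
SlopeCF : Seq AB → (ℕ → ℕ) → Set
SlopeCF u c = (∀ n → 1 ≤ c (suc n)) × ConvergesToCF (countA u) (countB u) c

colour : {A A' : Set} → Seq AB → Seq A → Seq A' → Seq (A ⊎ A')
colour u y y' n with u n
... | a = inj₁ (y (countA u n))
... | b = inj₂ (y' (countB u n))

-- y = (1 2 ... δ)^ω, letters 1..δ represented by Fin δ
cyc : (δ : ℕ) → .{{NonZero δ}} → Seq (Fin δ)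
cyc δ i = i mod δ

-- x_{2δ} = colour(u, y, y') with alphabet {1..δ} ⊎ {1'..δ'}
x2δ : (δ : ℕ) → .{{NonZero δ}} → Seq AB → Seq (Fin δ ⊎ Fin δ)
x2δ δ u = colour u (cyc δ) (cyc δ)

π₀ : {A A' : Set} → A ⊎ A' → AB
π₀ (inj₁ _) = a
π₀ (inj₂ _) = b

π : {A A' : Set} → List (A ⊎ A') → List AB
π = map π₀

ReturnWord : {A : Set} → List A → List A → Seq A → Set
ReturnWord v w x = Σ ℕ λ i → Σ ℕ λ j → (i < j) × OccursAt w x i × OccursAt w x j ×
  (∀ k → i < k → k < j → ¬ OccursAt w x k) × (v ≡ slice x i (j ∸ i))

RightSpecial LeftSpecial Bispecial : {A : Set} → List A → Seq A → Set
RightSpecial w x = Σ _ λ c → Σ _ λ d → c ≢ d × Factor (w ∷ʳ c) x × Factor (w ∷ʳ d) x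
LeftSpecial w x = Σ _ λ c → Σ _ λ d → c ≢ d × Factor (c ∷ w) x × Factor (d ∷ w) x
Bispecial w x = RightSpecial w x × LeftSpecial w x

{-# OPTIONS --safe #-}
-- The letter of x2δ at position m is u_m tagged with the number of occurrences of u_m
-- in u_0 ⋯ u_{m-1}, modulo δ.  If π w contains both letters, matching two occurrences
-- of w in x2δ letter by letter shows that both counts agree modulo δ at their starting
-- positions, so the gap between them (the projection of a return word) has both counts
-- divisible by δ.  Moreover two extensions of w with the same projection then land on
-- positions with the same letter of u and the same counts, hence are equal letters of
-- x2δ; so distinct extensions of w project to distinct extensions of π w.
module Submission where

open import Defs
open import Data.Nat using (ℕ; zero; suc; _≤_; _+_; _*_; _∸_; pred; _%_; _/_; NonZero)
open import Data.Nat.Properties using (+-suc; +-comm; +-assoc; suc-pred; +-identityʳ; m+[n∸m]≡n; <⇒≤)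
open import Data.Nat.DivMod using (_mod_; m%n<n; %-distribˡ-+; [m+kn]%n≡m%n; m*n%n≡0)
open import Data.Nat.Divisibility using (_∣_; m%n≡0⇒n∣m)
open import Data.Nat.Tactic.RingSolver using (solve-∀)
open import Data.Fin using (Fin; toℕ)
open import Data.Fin.Properties using (toℕ-fromℕ<; toℕ-injective)
open import Data.List using (List; []; _∷_; _∷ʳ_; length)
open import Data.List.Properties using (∷-injective; length-map; map-++)
open import Data.List.Membership.Propositional using (_∈_)
open import Data.List.Relation.Unary.Any using (here; there)
open import Data.Sum using (_⊎_; inj₁; inj₂)
open import Data.Sum.Properties using (inj₁-injective; inj₂-injective)
open import Data.Product using (_×_; _,_; proj₁; proj₂)
open import Relation.Nullary using (yes; no; contradiction)
open import Relation.Binary.Definitions using (DecidableEquality)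
open import Relation.Binary.PropositionalEquality
  using (_≡_; _≢_; refl; sym; trans; cong; cong₂; subst; module ≡-Reasoning)

open ≡-Reasoning

_≟_ : DecidableEquality AB
a ≟ a = yes refl
a ≟ b = no λ ()
b ≟ a = no λ ()
b ≟ b = yes refl

count : AB → Seq AB → ℕ → ℕ
count a = countA
count b = countB

occ : AB → List AB → ℕ
occ a = ∣_∣ₐ
occ b = ∣_∣ᵦ

every-letter : {w : List AB} → a ∈ w → b ∈ w → ∀ l → l ∈ w
every-letter a∈w b∈w a = a∈w
every-letter a∈w b∈w b = b∈w

occ-∷ : ∀ l c w → occ l (c ∷ w) ≡ occ l (c ∷ []) + occ l w
occ-∷ a a w = refl
occ-∷ a b w = refl
occ-∷ b a w = refl
occ-∷ b b w = refl

count-suc : ∀ l u m → count l u (suc m) ≡ occ l (u m ∷ []) + count l u m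
count-suc a u m with u m
... | a = refl
... | b = refl
count-suc b u m with u m
... | a = refl
... | b = refl

count-slice : ∀ l u i n → count l u (i + n) ≡ occ l (slice u i n) + count l u i
count-slice a u i zero = cong (countA u) (+-identityʳ i)
count-slice b u i zero = cong (countB u) (+-identityʳ i)
count-slice l u i (suc n) = begin
  count l u (i + suc n)                                   ≡⟨ cong (count l u) (+-suc i n) ⟩
  count l u (suc i + n)                                   ≡⟨ count-slice l u (suc i) n ⟩
  occ l s + count l u (suc i)                             ≡⟨ cong (occ l s +_) (count-suc l u i) ⟩
  occ l s + (occ l (u i ∷ []) + count l u i)              ≡⟨ +-assoc (occ l s) _ _ ⟨
  (occ l s + occ l (u i ∷ [])) + count l u i              ≡⟨ cong (_+ count l u i) (+-comm (occ l s) _) ⟩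
  (occ l (u i ∷ []) + occ l s) + count l u i              ≡⟨ cong (_+ count l u i) (sym (occ-∷ l (u i) s)) ⟩
  occ l (u i ∷ s) + count l u i                           ∎
  where s = slice u (suc i) n

module _ {d : ℕ} .{{_ : NonZero d}} where

  %-cong-+ˡ : ∀ k {m n} → m % d ≡ n % d → (k + m) % d ≡ (k + n) % d
  %-cong-+ˡ k {m} {n} e = begin
    (k + m) % d              ≡⟨ %-distribˡ-+ k m d ⟩
    (k % d + m % d) % d      ≡⟨ cong (λ t → (k % d + t) % d) e ⟩
    (k % d + n % d) % d      ≡⟨ %-distribˡ-+ k n d ⟨
    (k + n) % d              ∎

  -- Adding pred d * k undoes adding k, since k + pred d * k = k * d.
  %-cancel-+ˡ : ∀ k {m n} → (k + m) % d ≡ (k + n) % d → m % d ≡ n % d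
  %-cancel-+ˡ k {m} {n} e = begin
    m % d                       ≡⟨ [m+kn]%n≡m%n m k d ⟨
    (m + k * d) % d             ≡⟨ cong (_% d) (undo m) ⟩
    (pred d * k + (k + m)) % d  ≡⟨ %-cong-+ˡ (pred d * k) e ⟩
    (pred d * k + (k + n)) % d  ≡⟨ cong (_% d) (undo n) ⟨
    (n + k * d) % d             ≡⟨ [m+kn]%n≡m%n n k d ⟩
    n % d                       ∎
    where
    rearrange : ∀ m k d′ → m + k * suc d′ ≡ d′ * k + (k + m)
    rearrange = solve-∀
    undo : ∀ m → m + k * d ≡ pred d * k + (k + m)
    undo m = trans (cong (λ e → m + k * e) (sym (suc-pred d))) (rearrange m k (pred d))

  %-≡-+⇒∣ : ∀ m t → m % d ≡ (t + m) % d → d ∣ t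
  %-≡-+⇒∣ m t e = m%n≡0⇒n∣m t d (trans t%d≡0%d (m*n%n≡0 0 d))
    where
    t%d≡0%d : t % d ≡ 0 % d
    t%d≡0%d = %-cancel-+ˡ m (begin
      (m + t) % d  ≡⟨ cong (_% d) (+-comm m t) ⟩
      (t + m) % d  ≡⟨ e ⟨
      m % d        ≡⟨ cong (_% d) (+-identityʳ m) ⟨
      (m + 0) % d  ∎)

  mod-injective : ∀ {m n} → m mod d ≡ n mod d → m % d ≡ n % d
  mod-injective {m} {n} e = begin
    m % d          ≡⟨ toℕ-fromℕ< (m%n<n m d) ⟨
    toℕ (m mod d)  ≡⟨ cong toℕ e ⟩
    toℕ (n mod d)  ≡⟨ toℕ-fromℕ< (m%n<n n d) ⟩
    n % d          ∎

  %≡⇒mod≡ : ∀ {m n} → m % d ≡ n % d → m mod d ≡ n mod d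
  %≡⇒mod≡ {m} {n} e = toℕ-injective (begin
    toℕ (m mod d)  ≡⟨ toℕ-fromℕ< (m%n<n m d) ⟩
    m % d          ≡⟨ e ⟩
    n % d          ≡⟨ toℕ-fromℕ< (m%n<n n d) ⟨
    toℕ (n mod d)  ∎)

  count-%-step : ∀ l u {i j n} → slice u i n ≡ slice u j n →
    count l u i % d ≡ count l u j % d → count l u (i + n) % d ≡ count l u (j + n) % d
  count-%-step l u {i} {j} {n} same e = begin
    count l u (i + n) % d                   ≡⟨ cong (_% d) (count-slice l u i n) ⟩
    (occ l (slice u i n) + count l u i) % d ≡⟨ %-cong-+ˡ (occ l (slice u i n)) e ⟩
    (occ l (slice u i n) + count l u j) % d ≡⟨ cong (λ s → (occ l s + count l u j) % d) same ⟩
    (occ l (slice u j n) + count l u j) % d ≡⟨ cong (_% d) (count-slice l u j n) ⟨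
    count l u (j + n) % d                   ∎

  count-%-unstep : ∀ l u {i j} → u i ≡ u j →
    count l u (suc i) % d ≡ count l u (suc j) % d → count l u i % d ≡ count l u j % d
  count-%-unstep l u {i} {j} same e = %-cancel-+ˡ (occ l (u i ∷ [])) (begin
    (occ l (u i ∷ []) + count l u i) % d  ≡⟨ cong (_% d) (count-suc l u i) ⟨
    count l u (suc i) % d                 ≡⟨ e ⟩
    count l u (suc j) % d                 ≡⟨ cong (_% d) (count-suc l u j) ⟩
    (occ l (u j ∷ []) + count l u j) % d  ≡⟨ cong (λ c → (occ l (c ∷ []) + count l u j) % d) same ⟨
    (occ l (u i ∷ []) + count l u j) % d  ∎)

module _ {A A′ : Set} (u : Seq AB) (y : Seq A) (y′ : Seq A′) where

  π₀-colour : ∀ m → π₀ (colour u y y′ m) ≡ u m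
  π₀-colour m with u m
  ... | a = refl
  ... | b = refl

  π-slice-colour : ∀ i n → π (slice (colour u y y′) i n) ≡ slice u i n
  π-slice-colour i zero = refl
  π-slice-colour i (suc n) = cong₂ _∷_ (π₀-colour i) (π-slice-colour (suc i) n)

  OccursAt-π : ∀ {w i} → OccursAt w (colour u y y′) i → OccursAt (π w) u i
  OccursAt-π {w} {i} o = begin
    slice u i (length (π w))                ≡⟨ cong (slice u i) (length-map π₀ w) ⟩
    slice u i (length w)                    ≡⟨ π-slice-colour i (length w) ⟨
    π (slice (colour u y y′) i (length w))  ≡⟨ cong π o ⟩
    π w                                     ∎

  Factor-π : ∀ {w} → Factor w (colour u y y′) → Factor (π w) u
  Factor-π (i , o) = i , OccursAt-π o

  RightSpecial-π : ∀ {w} →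
    (∀ {c c′} → Factor (w ∷ʳ c) (colour u y y′) → Factor (w ∷ʳ c′) (colour u y y′) → π₀ c ≡ π₀ c′ → c ≡ c′) →
    RightSpecial w (colour u y y′) → RightSpecial (π w) u
  RightSpecial-π {w} unique (c , c′ , c≢c′ , wc , wc′) with π₀ c ≟ π₀ c′
  ... | yes same = contradiction (unique wc wc′ same) c≢c′
  ... | no differ = π₀ c , π₀ c′ , differ , project wc , project wc′
    where
    project : ∀ {e} → Factor (w ∷ʳ e) (colour u y y′) → Factor (π w ∷ʳ π₀ e) u
    project {e} f = subst (λ t → Factor t u) (map-++ π₀ w (e ∷ [])) (Factor-π f)

  LeftSpecial-π : ∀ {w} →
    (∀ {c c′} → Factor (c ∷ w) (colour u y y′) → Factor (c′ ∷ w) (colour u y y′) → π₀ c ≡ π₀ c′ → c ≡ c′) →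
    LeftSpecial w (colour u y y′) → LeftSpecial (π w) u
  LeftSpecial-π unique (c , c′ , c≢c′ , cw , c′w) with π₀ c ≟ π₀ c′
  ... | yes same = contradiction (unique cw c′w same) c≢c′
  ... | no differ = π₀ c , π₀ c′ , differ , Factor-π cw , Factor-π c′w

OccursAt-∷ʳ : {A : Set} (x : Seq A) (w : List A) {c : A} {i : ℕ} →
  OccursAt (w ∷ʳ c) x i → OccursAt w x i × x (i + length w) ≡ c
OccursAt-∷ʳ x [] {i = i} o = refl , trans (cong x (+-identityʳ i)) (proj₁ (∷-injective o))
OccursAt-∷ʳ x (e ∷ w) {i = i} o with ∷-injective o
... | xi≡e , rest with OccursAt-∷ʳ x w rest
...   | w-at , last = cong₂ _∷_ xi≡e w-at , trans (cong x (+-suc i (length w))) last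

module _ (δ : ℕ) .{{_ : NonZero δ}} (u : Seq AB) where

  private
    x : Seq (Fin δ ⊎ Fin δ)
    x = x2δ δ u

  embed : AB → Fin δ → Fin δ ⊎ Fin δ
  embed a = inj₁
  embed b = inj₂

  embed-injective : ∀ l {f g} → embed l f ≡ embed l g → f ≡ g
  embed-injective a = inj₁-injective
  embed-injective b = inj₂-injective

  x2δ-at : ∀ m → x m ≡ embed (u m) (count (u m) u m mod δ)
  x2δ-at m with u m
  ... | a = refl
  ... | b = refl

  x2δ-≡⇒ : ∀ {i j} → x i ≡ x j → u i ≡ u j × count (u i) u i % δ ≡ count (u i) u j % δ
  x2δ-≡⇒ {i} {j} e = same , mod-injective (embed-injective (u i) (begin
      embed (u i) (count (u i) u i mod δ)  ≡⟨ x2δ-at i ⟨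
      x i                                  ≡⟨ e ⟩
      x j                                  ≡⟨ x2δ-at j ⟩
      embed (u j) (count (u j) u j mod δ)  ≡⟨ cong (λ l → embed l (count l u j mod δ)) same ⟨
      embed (u i) (count (u i) u j mod δ)  ∎))
    where
    same : u i ≡ u j
    same = trans (sym (π₀-colour u _ _ i)) (trans (cong π₀ e) (π₀-colour u _ _ j))

  x2δ-≡⇐ : ∀ {i j} → u i ≡ u j → count (u i) u i % δ ≡ count (u i) u j % δ → x i ≡ x j
  x2δ-≡⇐ {i} {j} same e = begin
    x i                                  ≡⟨ x2δ-at i ⟩
    embed (u i) (count (u i) u i mod δ)  ≡⟨ cong (embed (u i)) (%≡⇒mod≡ e) ⟩
    embed (u i) (count (u i) u j mod δ)  ≡⟨ cong (λ l → embed l (count l u j mod δ)) same ⟩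
    embed (u j) (count (u j) u j mod δ)  ≡⟨ x2δ-at j ⟨
    x j                                  ∎

  -- At an occurrence of l the equal letters of x force equal counts of l mod δ; the
  -- equal letters before it shift both counts equally.
  count-%-from-letter : ∀ {l} i j n → slice x i n ≡ slice x j n → l ∈ π (slice x i n) →
    count l u i % δ ≡ count l u j % δ
  count-%-from-letter i j (suc n) same (here l≡xi) =
    subst (λ l → count l u i % δ ≡ count l u j % δ)
      (sym (trans l≡xi (π₀-colour u _ _ i))) (proj₂ (x2δ-≡⇒ (proj₁ (∷-injective same))))
  count-%-from-letter {l} i j (suc n) same (there l∈rest) =
    count-%-unstep l u (proj₁ (x2δ-≡⇒ (proj₁ (∷-injective same))))
      (count-%-from-letter (suc i) (suc j) n (proj₂ (∷-injective same)) l∈rest)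

  count-%-occurrences : ∀ {w l i j} → l ∈ π w → OccursAt w x i → OccursAt w x j →
    count l u i % δ ≡ count l u j % δ
  count-%-occurrences {w} {l} l∈w wi wj =
    count-%-from-letter _ _ (length w) (trans wi (sym wj)) (subst (λ t → l ∈ π t) (sym wi) l∈w)

  ReturnWord-occ-divisible : ∀ {v w} l → l ∈ π w → ReturnWord v w x → δ ∣ occ l (π v)
  ReturnWord-occ-divisible {v} l l∈w (i , j , i<j , wi , wj , _ , v≡) =
    %-≡-+⇒∣ (count l u i) _ (begin
      count l u i % δ                            ≡⟨ count-%-occurrences l∈w wi wj ⟩
      count l u j % δ                            ≡⟨ cong (λ k → count l u k % δ) (m+[n∸m]≡n (<⇒≤ i<j)) ⟨
      count l u (i + (j ∸ i)) % δ                ≡⟨ cong (_% δ) (count-slice l u i (j ∸ i)) ⟩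
      (occ l (slice u i (j ∸ i)) + count l u i) % δ
        ≡⟨ cong (λ s → (occ l s + count l u i) % δ) (trans (cong π v≡) (π-slice-colour u _ _ i (j ∸ i))) ⟨
      (occ l (π v) + count l u i) % δ            ∎)

  module _ {w : List (Fin δ ⊎ Fin δ)} (a∈w : a ∈ π w) (b∈w : b ∈ π w) where

    in-phase : ∀ {i j} → OccursAt w x i → OccursAt w x j → ∀ l → count l u i % δ ≡ count l u j % δ
    in-phase wi wj l = count-%-occurrences (every-letter a∈w b∈w l) wi wj

    right-extension-unique : ∀ {c c′} → Factor (w ∷ʳ c) x → Factor (w ∷ʳ c′) x → π₀ c ≡ π₀ c′ → c ≡ c′
    right-extension-unique {c} {c′} (i , wci) (j , wc′j) same
      with OccursAt-∷ʳ x w wci | OccursAt-∷ʳ x w wc′j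
    ... | wi , xi≡c | wj , xj≡c′ = begin
      c                ≡⟨ xi≡c ⟨
      x (i + length w) ≡⟨ x2δ-≡⇐ next-same next-in-phase ⟩
      x (j + length w) ≡⟨ xj≡c′ ⟩
      c′               ∎
      where
      u-same : slice u i (length w) ≡ slice u j (length w)
      u-same = begin
        slice u i (length w)       ≡⟨ π-slice-colour u _ _ i (length w) ⟨
        π (slice x i (length w))   ≡⟨ cong π (trans wi (sym wj)) ⟩
        π (slice x j (length w))   ≡⟨ π-slice-colour u _ _ j (length w) ⟩
        slice u j (length w)       ∎
      next-in-phase : count (u (i + length w)) u (i + length w) % δ
                    ≡ count (u (i + length w)) u (j + length w) % δ
      next-in-phase = count-%-step (u (i + length w)) u u-same (in-phase wi wj (u (i + length w)))
      next-same : u (i + length w) ≡ u (j + length w)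
      next-same = begin
        u (i + length w)           ≡⟨ π₀-colour u _ _ (i + length w) ⟨
        π₀ (x (i + length w))      ≡⟨ cong π₀ xi≡c ⟩
        π₀ c                       ≡⟨ same ⟩
        π₀ c′                      ≡⟨ cong π₀ xj≡c′ ⟨
        π₀ (x (j + length w))      ≡⟨ π₀-colour u _ _ (j + length w) ⟩
        u (j + length w)           ∎

    left-extension-unique : ∀ {c c′} → Factor (c ∷ w) x → Factor (c′ ∷ w) x → π₀ c ≡ π₀ c′ → c ≡ c′
    left-extension-unique {c} {c′} (i , cwi) (j , c′wj) same
      with ∷-injective cwi | ∷-injective c′wj
    ... | xi≡c , wi | xj≡c′ , wj = begin
      c    ≡⟨ xi≡c ⟨
      x i  ≡⟨ x2δ-≡⇐ u-same (count-%-unstep (u i) u u-same (in-phase wi wj (u i))) ⟩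
      x j  ≡⟨ xj≡c′ ⟩
      c′   ∎
      where
      u-same : u i ≡ u j
      u-same = begin
        u i        ≡⟨ π₀-colour u _ _ i ⟨
        π₀ (x i)   ≡⟨ cong π₀ xi≡c ⟩
        π₀ c       ≡⟨ same ⟩
        π₀ c′      ≡⟨ cong π₀ xj≡c′ ⟨
        π₀ (x j)   ≡⟨ π₀-colour u _ _ j ⟩
        u j        ∎

lemma4 : (δ : ℕ) → 6 ≤ δ → .{{_ : NonZero δ}} →
    (u : Seq AB) → Standard u →
    (c : ℕ → ℕ) → c 0 ≡ 0 → c 1 ≡ 1 → c 2 ≡ δ / 2 → SlopeCF u c →
    (w : List (Fin δ ⊎ Fin δ)) → w ≢ [] → Factor w (x2δ δ u) →
    a ∈ π w → b ∈ π w →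
    ((v : List (Fin δ ⊎ Fin δ)) → ReturnWord v w (x2δ δ u) →
       (δ ∣ ∣ π v ∣ₐ) × (δ ∣ ∣ π v ∣ᵦ))
    × (Bispecial w (x2δ δ u) → Bispecial (π w) u)
lemma4 δ _ u _ _ _ _ _ _ w _ _ a∈w b∈w =
  (λ v r → ReturnWord-occ-divisible δ u a a∈w r , ReturnWord-occ-divisible δ u b b∈w r) ,
  λ (right , left) →
    RightSpecial-π u _ _ (right-extension-unique δ u a∈w b∈w) right ,
    LeftSpecial-π u _ _ (left-extension-unique δ u a∈w b∈w) left
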